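{- Let $2^{[n]}$ denote the Boolean lattice of all subsets of $[n]=\{1,\dots,n\}$ ordered by inclusion. Then $\operatorname{ldim}(2^{[n]})\ge (1-o(1))\,n/\log_2 n$ as $n\to\infty$.
   Context: Local dimension: a partial linear extension of a poset $\mathcal{P}=(P,\le)$ is a linear extension of an induced subposet. A local realizer is a nonempty set $\mathcal{L}$ of partial linear extensions such that (1) if $x<y$ in $\mathcal{P}$ then $x<y$ in some $L\in\mathcal{L}$, and (2) if $x,y$ are incomparable then $x<y$ in some $L\in\mathcal{L}$ and $y<x$ in some $L'\in\mathcal{L}$. $\operatorname{ldim}(\mathcal{P})$ is the least $k$ such that some local realizer has every element of $P$ in at most $k$ of its members. -}

module Defs where

open import Data.Nat using (ℕ; _≤_)
open import Data.Bool using (Bool)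
import Data.Bool.Properties as BoolP
open import Data.Vec.Properties using (≡-dec)
open import Data.List using (List; []; _∷_; _++_; length; filter)
open import Data.List.Relation.Unary.All using (All)
open import Data.List.Relation.Unary.Any using (Any)
open import Data.List.Relation.Unary.Unique.Propositional using (Unique)
open import Data.List.Membership.DecPropositional using (_∈?_)
open import Data.Product using (_×_; ∃)
open import Data.Sum using (_⊎_)
open import Data.Fin.Subset using (Subset; _⊆_)
open import Relation.Nullary using (¬_)
open import Relation.Binary.Definitions using (DecidableEquality)
open import Relation.Binary.PropositionalEquality using (_≡_; _≢_)

module LocalDim {A : Set} (_≼_ : A → A → Set) (_≟_ : DecidableEquality A) where

  _≺_ : A → A → Set
  x ≺ y = (x ≼ y) × (x ≢ y)

  Incomparable : A → A → Set
  Incomparable x y = ¬ (x ≼ y ⊎ y ≼ x)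

  Before : List A → A → A → Set
  Before L x y = ∃ λ l₁ → ∃ λ l₂ → ∃ λ l₃ → L ≡ l₁ ++ (x ∷ l₂ ++ (y ∷ l₃))

  -- a partial linear extension: a linear order (list without repetitions)
  -- on a subset of A, which is a linear extension of the induced subposet
  IsPartialLinearExtension : List A → Set
  IsPartialLinearExtension L = Unique L × (∀ x y → Before L x y → ¬ (y ≺ x))

  IsLocalRealizer : List (List A) → Set
  IsLocalRealizer Ls =
    (Ls ≢ []) ×
    All IsPartialLinearExtension Ls ×
    (∀ x y → x ≺ y → Any (λ L → Before L x y) Ls) ×
    (∀ x y → Incomparable x y → Any (λ L → Before L x y) Ls)
    -- (the "y<x in some L'" half of (2) is the same clause with x,y swapped)

  occurrences : A → List (List A) → ℕ
  occurrences x Ls = length (filter (λ L → _∈?_ _≟_ x L) Ls)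

  LdimAtMost : ℕ → Set
  LdimAtMost k = ∃ λ Ls → IsLocalRealizer Ls × (∀ x → occurrences x Ls ≤ k)

BooleanLdimAtMost : ℕ → ℕ → Set
BooleanLdimAtMost n k = LocalDim.LdimAtMost {Subset n} _⊆_ (≡-dec BoolP._≟_) k

module Submission where

-- Fix a local realizer of 2^[n] in which every set lies in at most k members.
-- For j ∉ A the singleton ⁅ j ⁆ is not below A, so it is listed after A in some
-- member (A lies below ⁅ j ⁆ or is incomparable to it); for j ∈ A it never is.
-- In a member L containing A, the singletons listed after A are the first of
-- them, ⁅ i ⁆, together with those listed after ⁅ i ⁆ in L.  So A is determined
-- by at most k pairs (i , L) with ⁅ i ⁆ ∈ L, and there are at most n k such
-- pairs.  Hence 2^n ≤ Σ_{j ≤ k} C(n k, j) ≤ (n k + k)^k / k! ≤ (4 (n + 1))^k,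
-- using k^k ≤ 4^k k!, and raising 2^n ≤ (8 n)^k to the q-th power gives
-- 2^(q n) ≤ 8^(q k) n^(q k) ≤ n^(k (q + 1)) as soon as n ≥ 8^q.

open import Defs
open import Data.Nat using (ℕ; zero; suc; _+_; _*_; _^_; _≤_; z≤n; s≤s; _!)
open import Data.Nat.Properties hiding (_≟_)
open import Data.Nat.Tactic.RingSolver using (solve-∀)
open import Data.Nat.ListAction using (sum)
open import Data.Bool using (Bool; true; false; not)
import Data.Bool.Properties as BoolP
open import Data.Fin using (Fin)
import Data.Fin.Properties as FinP
open import Data.Fin.Subset using (Subset; _⊆_; _∈_; _∉_; ⁅_⁆)
open import Data.Fin.Subset.Properties using (⊆-refl; _⊆?_; x∈⁅x⁆; x∈⁅y⁆⇒x≡y)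
open import Data.Vec using (Vec; []; _∷_; tabulate; lookup)
open import Data.Vec.Properties using (≡-dec; tabulate-cong; tabulate∘lookup; lookup⇒[]=; []=⇒lookup)
open import Data.List using (List; []; _∷_; _++_; concatMap; map; filter; length; allFin)
open import Data.List.Properties using (length-++; length-map; length-tabulate)
open import Data.List.Relation.Binary.Sublist.Propositional
  using ([]; _∷_; _∷ʳ_; from∈; minimum) renaming (_⊆_ to _⊑_)
open import Data.List.Relation.Binary.Sublist.Propositional.Properties using (++⁺)
open import Data.List.Relation.Unary.All as All using (All; _∷_)
open import Data.List.Relation.Unary.Any as Any using (Any; here; there)
open import Data.List.Relation.Unary.Any.Properties using (concatMap⁺; concatMap⁻)
open import Data.List.Relation.Unary.AllPairs using (_∷_)
open import Data.List.Relation.Unary.Unique.Propositional using (Unique)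
open import Data.List.Membership.Propositional using () renaming (_∈_ to _∈ₗ_; _∉_ to _∉ₗ_)
open import Data.List.Membership.Propositional.Properties
  using (∈-++⁺ˡ; ∈-++⁺ʳ; ∈-∃++; ∈-map⁺; ∈-filter⁺; ∈-allFin)
import Data.List.Membership.DecPropositional as ListDec
open import Data.Maybe using (Maybe; just; nothing)
open import Data.Product using (∃; _×_; _,_)
open import Data.Sum as Sum using (_⊎_; inj₁; inj₂; [_,_])
open import Data.Empty using (⊥-elim)
open import Function using (_∘_; id)
open import Relation.Nullary using (¬_; Dec; yes; no; does)
open import Relation.Nullary.Decidable using (_⊎-dec_; dec-true; dec-false)
open import Relation.Binary.Core using (_Preserves_⟶_)
open import Relation.Binary.Definitions using (DecidableEquality; Decidable; Reflexive)
open import Relation.Binary.PropositionalEquality hiding ([_])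
open import Algebra.Properties.CommutativeSemigroup +-commutativeSemigroup
  using () renaming (x∙yz≈y∙xz to x+[y+z]≡y+[x+z])
open import Algebra.Properties.CommutativeSemigroup *-commutativeSemigroup
  using () renaming (x∙yz≈y∙xz to x*[y*z]≡y*[x*z])

^-distribʳ-* : ∀ m n o → (m * n) ^ o ≡ m ^ o * n ^ o
^-distribʳ-* m n zero    = refl
^-distribʳ-* m n (suc o) = begin
  m * n * (m * n) ^ o      ≡⟨ cong (m * n *_) (^-distribʳ-* m n o) ⟩
  m * n * (m ^ o * n ^ o)  ≡⟨ interchange m n (m ^ o) (n ^ o) ⟩
  m * m ^ o * (n * n ^ o)  ∎
  where
  open ≡-Reasoning
  interchange : ∀ a b c d → a * b * (c * d) ≡ a * c * (b * d)
  interchange = solve-∀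

-- (1 + 1/x)^k ≤ (x + 1) / (x + 1 - k), with the denominators cleared.
[1+x]^k*r≤x^k*[1+x] : ∀ k r x → k + r ≡ suc x → suc x ^ k * r ≤ x ^ k * suc x
[1+x]^k*r≤x^k*[1+x] zero    r x refl = ≤-refl
[1+x]^k*r≤x^k*[1+x] (suc k) r x k+r≡ = begin
  suc x * suc x ^ k * r    ≡⟨ rearrange (suc x) (suc x ^ k) r ⟩
  suc x ^ k * (suc x * r)  ≤⟨ *-monoʳ-≤ (suc x ^ k) [1+x]*r≤x*[1+r] ⟩
  suc x ^ k * (x * suc r)  ≡⟨ x*[y*z]≡y*[x*z] (suc x ^ k) x (suc r) ⟩
  x * (suc x ^ k * suc r)  ≤⟨ *-monoʳ-≤ x ([1+x]^k*r≤x^k*[1+x] k (suc r) x k+[1+r]≡) ⟩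
  x * (x ^ k * suc x)      ≡⟨ *-assoc x (x ^ k) (suc x) ⟨
  x * x ^ k * suc x        ∎
  where
  open ≤-Reasoning
  rearrange : ∀ a b c → a * b * c ≡ b * (a * c)
  rearrange = solve-∀
  k+[1+r]≡ : k + suc r ≡ suc x
  k+[1+r]≡ = trans (+-suc k r) k+r≡
  r≤x : r ≤ x
  r≤x = ≤-pred (subst (suc r ≤_) k+[1+r]≡ (m≤n+m (suc r) k))
  [1+x]*r≤x*[1+r] : suc x * r ≤ x * suc r
  [1+x]*r≤x*[1+r] = subst (suc x * r ≤_) (sym (*-suc x r)) (+-monoˡ-≤ (x * r) r≤x)

[1+n]^d≤2*n^d : ∀ d n → 2 * d ≤ n → suc n ^ d ≤ 2 * n ^ d
[1+n]^d≤2*n^d d n 2d≤n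
  with m≤n⇒∃[o]m+o≡n (m≤n⇒m≤1+n (≤-trans (m≤m+n d (d + 0)) 2d≤n))
... | r , d+r≡1+n = *-cancelʳ-≤ (suc n ^ d) (2 * n ^ d) (suc n) (begin
  suc n ^ d * suc n      ≤⟨ *-monoʳ-≤ (suc n ^ d) 1+n≤2r ⟩
  suc n ^ d * (2 * r)    ≡⟨ x*[y*z]≡y*[x*z] (suc n ^ d) 2 r ⟩
  2 * (suc n ^ d * r)    ≤⟨ *-monoʳ-≤ 2 ([1+x]^k*r≤x^k*[1+x] d r n d+r≡1+n) ⟩
  2 * (n ^ d * suc n)    ≡⟨ *-assoc 2 (n ^ d) (suc n) ⟨
  2 * n ^ d * suc n      ∎)
  where
  open ≤-Reasoning
  double : ∀ d r → (d + r) + (d + r) ≡ 2 * r + 2 * d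
  double = solve-∀
  1+n≤2r : suc n ≤ 2 * r
  1+n≤2r = +-cancelʳ-≤ (2 * d) (suc n) (2 * r) (begin
    suc n + 2 * d      ≤⟨ +-monoʳ-≤ (suc n) (m≤n⇒m≤1+n 2d≤n) ⟩
    suc n + suc n      ≡⟨ cong (λ m → m + m) d+r≡1+n ⟨
    (d + r) + (d + r)  ≡⟨ double d r ⟩
    2 * r + 2 * d      ∎)

[1+k]^k≤4*k^k : ∀ k → suc k ^ k ≤ 4 * k ^ k
[1+k]^k≤4*k^k k = *-cancelˡ-≤ (2 ^ k) {{m^n≢0 2 k}} (begin
  2 ^ k * suc k ^ k           ≡⟨ ^-distribʳ-* 2 (suc k) k ⟨
  (2 * suc k) ^ k             ≡⟨ cong (_^ k) (2*[1+k]≡ k) ⟩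
  suc (suc (2 * k)) ^ k       ≤⟨ [1+n]^d≤2*n^d k (suc (2 * k)) (n≤1+n (2 * k)) ⟩
  2 * suc (2 * k) ^ k         ≤⟨ *-monoʳ-≤ 2 ([1+n]^d≤2*n^d k (2 * k) ≤-refl) ⟩
  2 * (2 * (2 * k) ^ k)       ≡⟨ cong (λ m → 2 * (2 * m)) (^-distribʳ-* 2 k k) ⟩
  2 * (2 * (2 ^ k * k ^ k))   ≡⟨ regroup (2 ^ k) (k ^ k) ⟩
  2 ^ k * (4 * k ^ k)         ∎)
  where
  open ≤-Reasoning
  2*[1+k]≡ : ∀ k → 2 * suc k ≡ suc (suc (2 * k))
  2*[1+k]≡ = solve-∀
  regroup : ∀ a b → 2 * (2 * (a * b)) ≡ a * (4 * b)
  regroup = solve-∀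

k^k≤4^k*k! : ∀ k → k ^ k ≤ 4 ^ k * k !
k^k≤4^k*k! zero    = ≤-refl
k^k≤4^k*k! (suc k) = begin
  suc k * suc k ^ k            ≤⟨ *-monoʳ-≤ (suc k) ([1+k]^k≤4*k^k k) ⟩
  suc k * (4 * k ^ k)          ≤⟨ *-monoʳ-≤ (suc k) (*-monoʳ-≤ 4 (k^k≤4^k*k! k)) ⟩
  suc k * (4 * (4 ^ k * k !))  ≡⟨ regroup (suc k) (4 ^ k) (k !) ⟩
  4 * 4 ^ k * (suc k * k !)    ∎
  where
  open ≤-Reasoning
  regroup : ∀ a b c → a * (4 * (b * c)) ≡ 4 * b * (a * c)
  regroup = solve-∀

n!≤n^n : ∀ n → n ! ≤ n ^ n
n!≤n^n zero    = ≤-refl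
n!≤n^n (suc n) = *-monoʳ-≤ (suc n) (≤-trans (n!≤n^n n) (^-monoˡ-≤ n (n≤1+n n)))

x^[1+j]+[1+j]*x^j≤[1+x]^[1+j] : ∀ j x → x ^ suc j + suc j * x ^ j ≤ suc x ^ suc j
x^[1+j]+[1+j]*x^j≤[1+x]^[1+j] zero    x = ≤-reflexive (x*1+1*1≡ x)
  where x*1+1*1≡ : ∀ x → x * 1 + 1 * 1 ≡ suc x * 1
        x*1+1*1≡ = solve-∀
x^[1+j]+[1+j]*x^j≤[1+x]^[1+j] (suc j) x = begin
  x * (x * x ^ j) + suc (suc j) * (x * x ^ j)                   ≤⟨ m≤m+n _ _ ⟩
  x * (x * x ^ j) + suc (suc j) * (x * x ^ j) + suc j * x ^ j   ≡⟨ expand x (x ^ j) j ⟨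
  suc x * (x * x ^ j + suc j * x ^ j)                           ≤⟨ *-monoʳ-≤ (suc x) (x^[1+j]+[1+j]*x^j≤[1+x]^[1+j] j x) ⟩
  suc x * suc x ^ suc j                                         ∎
  where
  open ≤-Reasoning
  expand : ∀ x y j → suc x * (x * y + suc j * y) ≡ x * (x * y) + suc (suc j) * (x * y) + suc j * y
  expand = solve-∀

-- binomialSum m k = Σ_{j ≤ k} C(m, j), defined through Pascal's rule.
binomialSum : ℕ → ℕ → ℕ
binomialSum zero    k       = 1
binomialSum (suc m) zero    = 1
binomialSum (suc m) (suc k) = binomialSum m (suc k) + binomialSum m k

binomialSum-positive : ∀ m k → 1 ≤ binomialSum m k
binomialSum-positive zero    k       = ≤-refl
binomialSum-positive (suc m) zero    = ≤-refl
binomialSum-positive (suc m) (suc k) = ≤-trans (binomialSum-positive m (suc k)) (m≤m+n _ _)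

binomialSum-monoˡ-≤ : ∀ k → (λ m → binomialSum m k) Preserves _≤_ ⟶ _≤_
binomialSum-monoˡ-≤ k       {_}     {m′}    z≤n       = binomialSum-positive m′ k
binomialSum-monoˡ-≤ zero    {suc m} {suc m′} (s≤s m≤m′) = ≤-refl
binomialSum-monoˡ-≤ (suc k) {suc m} {suc m′} (s≤s m≤m′) =
  +-mono-≤ (binomialSum-monoˡ-≤ (suc k) m≤m′) (binomialSum-monoˡ-≤ k m≤m′)

k!*binomialSum≤[m+k]^k : ∀ m k → k ! * binomialSum m k ≤ (m + k) ^ k
k!*binomialSum≤[m+k]^k zero    k       = ≤-trans (≤-reflexive (*-identityʳ (k !))) (n!≤n^n k)
k!*binomialSum≤[m+k]^k (suc m) zero    = ≤-refl
k!*binomialSum≤[m+k]^k (suc m) (suc k) = begin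
  suc k ! * (binomialSum m (suc k) + binomialSum m k)
    ≡⟨ distrib (suc k) (k !) (binomialSum m (suc k)) (binomialSum m k) ⟩
  suc k ! * binomialSum m (suc k) + suc k * (k ! * binomialSum m k)
    ≤⟨ +-mono-≤ (k!*binomialSum≤[m+k]^k m (suc k)) (*-monoʳ-≤ (suc k) (k!*binomialSum≤[m+k]^k m k)) ⟩
  (m + suc k) ^ suc k + suc k * (m + k) ^ k
    ≡⟨ cong (λ x → x ^ suc k + suc k * (m + k) ^ k) (+-suc m k) ⟩
  suc (m + k) ^ suc k + suc k * (m + k) ^ k
    ≤⟨ +-monoʳ-≤ (suc (m + k) ^ suc k) (*-monoʳ-≤ (suc k) (^-monoˡ-≤ k (n≤1+n (m + k)))) ⟩
  suc (m + k) ^ suc k + suc k * suc (m + k) ^ k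
    ≤⟨ x^[1+j]+[1+j]*x^j≤[1+x]^[1+j] k (suc (m + k)) ⟩
  suc (suc (m + k)) ^ suc k
    ≡⟨ cong (λ x → suc x ^ suc k) (+-suc m k) ⟨
  (suc m + suc k) ^ suc k ∎
  where
  open ≤-Reasoning
  distrib : ∀ a b c d → a * b * (c + d) ≡ a * b * c + a * (b * d)
  distrib = solve-∀

binomialSum[n*k,k]≤[4*[1+n]]^k : ∀ n k → binomialSum (n * k) k ≤ (4 * suc n) ^ k
binomialSum[n*k,k]≤[4*[1+n]]^k n k = *-cancelˡ-≤ (k !) {{k !≢0}} (begin
  k ! * binomialSum (n * k) k    ≤⟨ k!*binomialSum≤[m+k]^k (n * k) k ⟩
  (n * k + k) ^ k                ≡⟨ cong (_^ k) (n*k+k≡ n k) ⟩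
  (k * suc n) ^ k                ≡⟨ ^-distribʳ-* k (suc n) k ⟩
  k ^ k * suc n ^ k              ≤⟨ *-monoˡ-≤ (suc n ^ k) (k^k≤4^k*k! k) ⟩
  4 ^ k * k ! * suc n ^ k        ≡⟨ regroup (4 ^ k) (k !) (suc n ^ k) ⟩
  k ! * (4 ^ k * suc n ^ k)      ≡⟨ cong (k ! *_) (^-distribʳ-* 4 (suc n) k) ⟨
  k ! * (4 * suc n) ^ k          ∎)
  where
  open ≤-Reasoning
  n*k+k≡ : ∀ n k → n * k + k ≡ k * suc n
  n*k+k≡ = solve-∀
  regroup : ∀ a b c → a * b * c ≡ b * (a * c)
  regroup = solve-∀

4*[1+n]≤8*n : ∀ {n} → 1 ≤ n → 4 * suc n ≤ 8 * n
4*[1+n]≤8*n {suc n} _ = ≤-trans (m≤m+n (4 * suc (suc n)) (4 * n)) (≤-reflexive (regroup n))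
  where regroup : ∀ n → 4 * suc (suc n) + 4 * n ≡ 8 * suc n
        regroup = solve-∀

2^[q*n]≤n^[k*[1+q]] : ∀ q {n} k → 8 ^ q ≤ n → 2 ^ n ≤ (8 * n) ^ k → 2 ^ (q * n) ≤ n ^ (k * suc q)
2^[q*n]≤n^[k*[1+q]] q {n} k 8^q≤n 2^n≤[8n]^k = begin
  2 ^ (q * n)              ≡⟨ cong (2 ^_) (*-comm q n) ⟩
  2 ^ (n * q)              ≡⟨ ^-*-assoc 2 n q ⟨
  (2 ^ n) ^ q              ≤⟨ ^-monoˡ-≤ q 2^n≤[8n]^k ⟩
  ((8 * n) ^ k) ^ q        ≡⟨ ^-*-assoc (8 * n) k q ⟩
  (8 * n) ^ (k * q)        ≡⟨ ^-distribʳ-* 8 n (k * q) ⟩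
  8 ^ (k * q) * n ^ (k * q) ≡⟨ cong (λ e → 8 ^ e * n ^ (k * q)) (*-comm k q) ⟩
  8 ^ (q * k) * n ^ (k * q) ≡⟨ cong (_* n ^ (k * q)) (^-*-assoc 8 q k) ⟨
  (8 ^ q) ^ k * n ^ (k * q) ≤⟨ *-monoˡ-≤ (n ^ (k * q)) (^-monoˡ-≤ k 8^q≤n) ⟩
  n ^ k * n ^ (k * q)      ≡⟨ ^-distribˡ-+-* n k (k * q) ⟨
  n ^ (k + k * q)          ≡⟨ cong (n ^_) (*-suc k q) ⟨
  n ^ (k * suc q)          ∎
  where open ≤-Reasoning

module _ {X : Set} where

  sublistsOfLength≤ : ℕ → List X → List (List X)
  sublistsOfLength≤ k       []       = [] ∷ []
  sublistsOfLength≤ zero    (y ∷ ys) = [] ∷ []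
  sublistsOfLength≤ (suc k) (y ∷ ys) = sublistsOfLength≤ (suc k) ys ++ map (y ∷_) (sublistsOfLength≤ k ys)

  length-sublistsOfLength≤ : ∀ k ys → length (sublistsOfLength≤ k ys) ≡ binomialSum (length ys) k
  length-sublistsOfLength≤ k       []       = refl
  length-sublistsOfLength≤ zero    (y ∷ ys) = refl
  length-sublistsOfLength≤ (suc k) (y ∷ ys) = trans (length-++ (sublistsOfLength≤ (suc k) ys))
    (cong₂ _+_ (length-sublistsOfLength≤ (suc k) ys)
               (trans (length-map (y ∷_) (sublistsOfLength≤ k ys)) (length-sublistsOfLength≤ k ys)))

  ∈-sublistsOfLength≤ : ∀ {k xs ys} → xs ⊑ ys → length xs ≤ k → xs ∈ₗ sublistsOfLength≤ k ys
  ∈-sublistsOfLength≤                []           _         = here refl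
  ∈-sublistsOfLength≤ {zero}  {[]}   (y ∷ʳ _)     _         = here refl
  ∈-sublistsOfLength≤ {suc k}        (y ∷ʳ xs⊑)   len       = ∈-++⁺ˡ (∈-sublistsOfLength≤ xs⊑ len)
  ∈-sublistsOfLength≤ {suc k}        (refl ∷ xs⊑) (s≤s len) =
    ∈-++⁺ʳ _ (∈-map⁺ (_ ∷_) (∈-sublistsOfLength≤ xs⊑ len))

tailsWith : ∀ {m} → Bool → List (Vec Bool (suc m)) → List (Vec Bool m)
tailsWith b []             = []
tailsWith b ((c ∷ v) ∷ vs) with b BoolP.≟ c
... | yes _ = v ∷ tailsWith b vs
... | no  _ = tailsWith b vs

length-tailsWith : ∀ {m} (vs : List (Vec Bool (suc m))) →
                   length (tailsWith true vs) + length (tailsWith false vs) ≡ length vs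
length-tailsWith []                 = refl
length-tailsWith ((true  ∷ v) ∷ vs) = cong suc (length-tailsWith vs)
length-tailsWith ((false ∷ v) ∷ vs) =
  trans (+-suc (length (tailsWith true vs)) _) (cong suc (length-tailsWith vs))

∈-tailsWith : ∀ {m b} {v : Vec Bool m} vs → b ∷ v ∈ₗ vs → v ∈ₗ tailsWith b vs
∈-tailsWith {b = b} ((c ∷ w) ∷ vs) b∷v∈ with b BoolP.≟ c | b∷v∈
... | yes refl | here refl  = here refl
... | yes refl | there b∷v∈ = there (∈-tailsWith vs b∷v∈)
... | no  b≢c  | here refl  = ⊥-elim (b≢c refl)
... | no  _    | there b∷v∈ = ∈-tailsWith vs b∷v∈

2^n≤length : ∀ n (vs : List (Vec Bool n)) → (∀ v → v ∈ₗ vs) → 2 ^ n ≤ length vs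
2^n≤length zero    []      complete with () ← complete []
2^n≤length zero    (_ ∷ _) _        = s≤s z≤n
2^n≤length (suc n) vs      complete = begin
  2 ^ n + (2 ^ n + 0)                                     ≡⟨ cong (2 ^ n +_) (+-identityʳ (2 ^ n)) ⟩
  2 ^ n + 2 ^ n                                           ≤⟨ +-mono-≤ (half true) (half false) ⟩
  length (tailsWith true vs) + length (tailsWith false vs) ≡⟨ length-tailsWith vs ⟩
  length vs                                               ∎
  where
  open ≤-Reasoning
  half : ∀ b → 2 ^ n ≤ length (tailsWith b vs)
  half b = 2^n≤length n (tailsWith b vs) (λ v → ∈-tailsWith vs (complete (b ∷ v)))

sum-map-≤ : ∀ {X : Set} (f : X → ℕ) {k} → (∀ x → f x ≤ k) → ∀ xs → sum (map f xs) ≤ length xs * k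
sum-map-≤ f f≤k []       = z≤n
sum-map-≤ f f≤k (x ∷ xs) = +-mono-≤ (f≤k x) (sum-map-≤ f f≤k xs)

module _ {X Y : Set} {R : X → Y → Set} (R? : ∀ x y → Dec (R x y)) where

  countˡ : List X → Y → ℕ
  countˡ xs y = length (filter (λ x → R? x y) xs)

  countʳ : X → List Y → ℕ
  countʳ x ys = length (filter (R? x) ys)

  sum-count-swap : ∀ xs ys → sum (map (countˡ xs) ys) ≡ sum (map (λ x → countʳ x ys) xs)
  sum-count-swap xs []       = sym (sum-zero xs)
    where
    sum-zero : ∀ xs → sum (map (λ x → countʳ x []) xs) ≡ 0
    sum-zero []       = refl
    sum-zero (_ ∷ xs) = sum-zero xs
  sum-count-swap xs (y ∷ ys) = trans (cong (countˡ xs y +_) (sum-count-swap xs ys)) (sym (sum-count-∷ xs))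
    where
    shift : ∀ a b c {s} → s ≡ b + c → a + s ≡ b + (a + c)
    shift a b c s≡b+c = trans (cong (a +_) s≡b+c) (x+[y+z]≡y+[x+z] a b c)
    sum-count-∷ : ∀ xs → sum (map (λ x → countʳ x (y ∷ ys)) xs) ≡ countˡ xs y + sum (map (λ x → countʳ x ys) xs)
    sum-count-∷ []       = refl
    sum-count-∷ (x ∷ xs) with R? x y
    ... | yes _ = cong suc (shift (countʳ x ys) (countˡ xs y) _ (sum-count-∷ xs))
    ... | no  _ = shift (countʳ x ys) (countˡ xs y) _ (sum-count-∷ xs)

zipWith-All-Any : ∀ {X : Set} {P Q R : X → Set} → (∀ {x} → P x → Q x → R x) →
                  ∀ {xs} → All P xs → Any Q xs → Any R xs
zipWith-All-Any f (p ∷ _)  (here q)  = here (f p q)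
zipWith-All-Any f (_ ∷ ps) (there q) = there (zipWith-All-Any f ps q)

module LocalRealizer {A : Set} (_≼_ : A → A → Set) (_≟_ : DecidableEquality A) where

  open LocalDim _≼_ _≟_

  after : A → List A → List A
  after x []       = []
  after x (y ∷ ys) with x ≟ y
  ... | yes _ = ys
  ... | no  _ = after x ys

  after-∷ : ∀ x ys → after x (x ∷ ys) ≡ ys
  after-∷ x ys with x ≟ x
  ... | yes _   = refl
  ... | no  x≢x = ⊥-elim (x≢x refl)

  module _ {x : A} where

    after-⊆ : ∀ {y} L → y ∈ₗ after x L → y ∈ₗ L
    after-⊆ (z ∷ zs) y∈ with x ≟ z
    ... | yes _ = there y∈
    ... | no  _ = there (after-⊆ zs y∈)

    after-∉ : ∀ L → x ∉ₗ L → after x L ≡ []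
    after-∉ []       _   = refl
    after-∉ (z ∷ zs) x∉ with x ≟ z
    ... | yes x≡z = ⊥-elim (x∉ (here x≡z))
    ... | no  _   = after-∉ zs (x∉ ∘ there)

    ∈-after⇒Before : ∀ {y} L → y ∈ₗ after x L → Before L x y
    ∈-after⇒Before (z ∷ zs) y∈ with x ≟ z
    ... | yes refl = let l₂ , l₃ , zs≡ = ∈-∃++ y∈ in [] , l₂ , l₃ , cong (x ∷_) zs≡
    ... | no  _    = let l₁ , l₂ , l₃ , zs≡ = ∈-after⇒Before zs y∈ in
                     z ∷ l₁ , l₂ , l₃ , cong (z ∷_) zs≡

    Before⇒∈-after : ∀ {y} L → Unique L → Before L x y → y ∈ₗ after x L
    Before⇒∈-after _ u (l₁ , l₂ , l₃ , refl) = go l₁ u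
      where
      go : ∀ {y l₂ l₃} l₁ → Unique (l₁ ++ x ∷ l₂ ++ y ∷ l₃) → y ∈ₗ after x (l₁ ++ x ∷ l₂ ++ y ∷ l₃)
      go {l₂ = l₂} [] _ = subst (_ ∈ₗ_) (sym (after-∷ x _)) (∈-++⁺ʳ l₂ (here refl))
      go (w ∷ l₁) (x∉ ∷ u) with x ≟ w
      ... | yes refl = ⊥-elim (All.lookup x∉ (∈-++⁺ʳ l₁ (here refl)) refl)
      ... | no  _    = go l₁ u

  after-∷-⊆ : ∀ {x y w} ws → y ∈ₗ after x ws → y ∈ₗ after x (w ∷ ws)
  after-∷-⊆ {x} {w = w} ws y∈ with x ≟ w
  ... | yes _ = after-⊆ ws y∈
  ... | no  _ = y∈

  after-after-⊆ : ∀ {x y z} L → z ∈ₗ after y (after x L) → z ∈ₗ after y L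
  after-after-⊆ {x} (w ∷ ws) z∈ with x ≟ w
  ... | yes _ = after-∷-⊆ ws z∈
  ... | no  _ = after-∷-⊆ ws (after-after-⊆ ws z∈)

  after-trans : ∀ {x y z} L → Unique L → y ∈ₗ after x L → z ∈ₗ after y L → z ∈ₗ after x L
  after-trans {x} {y} (w ∷ ws) (w∉ ∷ u) y∈ z∈ with x ≟ w | y ≟ w
  ... | yes _ | yes refl = ⊥-elim (All.lookup w∉ y∈ refl)
  ... | yes _ | no  _    = after-⊆ ws z∈
  ... | no  _ | yes refl = ⊥-elim (All.lookup w∉ (after-⊆ ws y∈) refl)
  ... | no  _ | no  _    = after-trans ws u y∈ z∈

  Before-irrefl : ∀ {L x} → Unique L → ¬ Before L x x
  Before-irrefl {x = x} u (l₁ , l₂ , l₃ , refl) = go l₁ u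
    where
    go : ∀ l₁ → ¬ Unique (l₁ ++ x ∷ l₂ ++ x ∷ l₃)
    go []       (x∉ ∷ _) = All.lookup x∉ (∈-++⁺ʳ l₂ (here refl)) refl
    go (_ ∷ l₁) (_ ∷ u)  = go l₁ u

  Before⇒⋡ : ∀ {L x y} → IsPartialLinearExtension L → Before L x y → ¬ (y ≼ x)
  Before⇒⋡ (u , ple) b y≼x = ple _ _ b (y≼x , λ { refl → Before-irrefl u b })

  ∈-after⇒⋡ : ∀ {Ls x y} → All IsPartialLinearExtension Ls → Any (λ L → y ∈ₗ after x L) Ls → ¬ (y ≼ x)
  ∈-after⇒⋡ ples y∈ = let ple , y∈′ = All.lookupAny ples y∈ in Before⇒⋡ ple (∈-after⇒Before _ y∈′)

  module _ (≼-refl : Reflexive _≼_) (_≼?_ : Decidable _≼_) where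

    ⋡⇒Before : ∀ {Ls x y} → IsLocalRealizer Ls → ¬ (y ≼ x) → Any (λ L → Before L x y) Ls
    ⋡⇒Before {x = x} {y} (_ , _ , strict , incomparable) y⋠x with x ≼? y
    ... | yes x≼y = strict x y (x≼y , λ { refl → y⋠x ≼-refl })
    ... | no  x⋠y = incomparable x y [ x⋠y , y⋠x ]

    ⋡⇒∈-after : ∀ {Ls x y} → IsLocalRealizer Ls → ¬ (y ≼ x) → Any (λ L → y ∈ₗ after x L) Ls
    ⋡⇒∈-after realizer@(_ , ples , _) y⋠x =
      zipWith-All-Any (λ (u , _) → Before⇒∈-after _ u) ples (⋡⇒Before realizer y⋠x)

module BooleanLattice (n : ℕ) where

  _≟_ : DecidableEquality (Subset n)
  _≟_ = ≡-dec BoolP._≟_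

  open LocalDim {Subset n} _⊆_ _≟_
  open LocalRealizer {Subset n} _⊆_ _≟_
  open ListDec _≟_ using (_∈?_)

  ∉⇒⁅⁆-after : ∀ {Ls A j} → IsLocalRealizer Ls → j ∉ A → Any (λ L → ⁅ j ⁆ ∈ₗ after A L) Ls
  ∉⇒⁅⁆-after realizer j∉A = ⋡⇒∈-after ⊆-refl _⊆?_ realizer (λ ⁅j⁆⊆A → j∉A (⁅j⁆⊆A (x∈⁅x⁆ _)))

  ⁅⁆-after⇒∉ : ∀ {Ls A j} → All IsPartialLinearExtension Ls → Any (λ L → ⁅ j ⁆ ∈ₗ after A L) Ls → j ∉ A
  ⁅⁆-after⇒∉ {A = A} ples ⁅j⁆-after j∈A =
    ∈-after⇒⋡ ples ⁅j⁆-after (λ x∈⁅j⁆ → subst (_∈ A) (sym (x∈⁅y⁆⇒x≡y _ x∈⁅j⁆)) j∈A)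

  firstSingleton : List (Subset n) → Maybe (Fin n)
  firstSingleton []       = nothing
  firstSingleton (B ∷ Bs) with FinP.any? (λ i → B ≟ ⁅ i ⁆)
  ... | yes (i , _) = just i
  ... | no  _       = firstSingleton Bs

  firstSingleton-∈ : ∀ M {i} → firstSingleton M ≡ just i → ⁅ i ⁆ ∈ₗ M
  firstSingleton-∈ (B ∷ Bs) eq with FinP.any? (λ i → B ≟ ⁅ i ⁆)
  firstSingleton-∈ (B ∷ Bs) refl | yes (i , B≡⁅i⁆) = here (sym B≡⁅i⁆)
  firstSingleton-∈ (B ∷ Bs) eq   | no  _           = there (firstSingleton-∈ Bs eq)

  firstSingleton-nothing : ∀ M {j} → firstSingleton M ≡ nothing → ⁅ j ⁆ ∉ₗ M
  firstSingleton-nothing (B ∷ Bs) eq ⁅j⁆∈ with FinP.any? (λ i → B ≟ ⁅ i ⁆) | ⁅j⁆∈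
  ... | no ¬singleton | here ⁅j⁆≡B = ¬singleton (_ , sym ⁅j⁆≡B)
  ... | no _          | there ⁅j⁆∈Bs = firstSingleton-nothing Bs eq ⁅j⁆∈Bs

  firstSingleton-just : ∀ M {i j} → firstSingleton M ≡ just i → ⁅ j ⁆ ∈ₗ M →
                        j ≡ i ⊎ ⁅ j ⁆ ∈ₗ after ⁅ i ⁆ M
  firstSingleton-just (B ∷ Bs) eq ⁅j⁆∈ with FinP.any? (λ i → B ≟ ⁅ i ⁆) | ⁅j⁆∈
  firstSingleton-just (_ ∷ Bs) refl _ | yes (i , refl) | here ⁅j⁆≡⁅i⁆ =
    inj₁ (x∈⁅y⁆⇒x≡y i (subst (_ ∈_) ⁅j⁆≡⁅i⁆ (x∈⁅x⁆ _)))
  firstSingleton-just (_ ∷ Bs) refl _ | yes (i , refl) | there ⁅j⁆∈Bs =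
    inj₂ (subst (_ ∈ₗ_) (sym (after-∷ ⁅ i ⁆ Bs)) ⁅j⁆∈Bs)
  ... | no ¬singleton | here ⁅j⁆≡B    = ⊥-elim (¬singleton (_ , sym ⁅j⁆≡B))
  ... | no _          | there ⁅j⁆∈Bs = Sum.map₂ (after-∷-⊆ Bs) (firstSingleton-just Bs eq ⁅j⁆∈Bs)

  -- A code (i , L) stands for the singletons listed after A in L, ⁅ i ⁆ being
  -- the first of them.
  Code : Set
  Code = Fin n × List (Subset n)

  Marks : Fin n → Code → Set
  Marks j (i , L) = j ≡ i ⊎ ⁅ j ⁆ ∈ₗ after ⁅ i ⁆ L

  Marks? : ∀ j c → Dec (Marks j c)
  Marks? j (i , L) = j FinP.≟ i ⊎-dec ⁅ j ⁆ ∈? after ⁅ i ⁆ L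

  entry : Subset n → List (Subset n) → List Code
  entry A L with firstSingleton (after A L)
  ... | just i  = (i , L) ∷ []
  ... | nothing = []

  encode : Subset n → List (List (Subset n)) → List Code
  encode A = concatMap (entry A)

  decode : List Code → Subset n
  decode c = tabulate (λ j → not (does (Any.any? (Marks? j) c)))

  ⁅⁆-after⇒marked : ∀ L {A j} → ⁅ j ⁆ ∈ₗ after A L → Any (Marks j) (entry A L)
  ⁅⁆-after⇒marked L {A} ⁅j⁆∈ with firstSingleton (after A L) in first
  ... | just i  = here (Sum.map₂ (after-after-⊆ L) (firstSingleton-just (after A L) first ⁅j⁆∈))
  ... | nothing = ⊥-elim (firstSingleton-nothing (after A L) first ⁅j⁆∈)

  marked⇒⁅⁆-after : ∀ L {A j} → Unique L → Any (Marks j) (entry A L) → ⁅ j ⁆ ∈ₗ after A L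
  marked⇒⁅⁆-after L {A} u marked with firstSingleton (after A L) in first | marked
  ... | just i | here (inj₁ refl) = firstSingleton-∈ (after A L) first
  ... | just i | here (inj₂ ⁅j⁆∈)  = after-trans L u (firstSingleton-∈ (after A L) first) ⁅j⁆∈

  decode-encode : ∀ {Ls} → IsLocalRealizer Ls → ∀ A → decode (encode A Ls) ≡ A
  decode-encode {Ls} realizer@(_ , ples , _) A =
    trans (tabulate-cong pointwise) (tabulate∘lookup A)
    where
    ∉⇒marked : ∀ {j} → j ∉ A → Any (Marks j) (encode A Ls)
    ∉⇒marked j∉A = concatMap⁺ (entry A) (Any.map (λ {L} → ⁅⁆-after⇒marked L) (∉⇒⁅⁆-after realizer j∉A))
    marked⇒∉ : ∀ {j} → Any (Marks j) (encode A Ls) → j ∉ A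
    marked⇒∉ marked = ⁅⁆-after⇒∉ ples
      (zipWith-All-Any (λ (u , _) → marked⇒⁅⁆-after _ u) ples (concatMap⁻ (entry A) marked))
    pointwise : ∀ j → not (does (Any.any? (Marks? j) (encode A Ls))) ≡ lookup A j
    pointwise j with lookup A j in A[j]
    ... | true  = cong not (dec-false (Any.any? (Marks? j) _) (λ m → marked⇒∉ m (lookup⇒[]= j A A[j])))
    ... | false = cong not (dec-true (Any.any? (Marks? j) _)
                    (∉⇒marked (λ j∈A → BoolP.not-¬ ([]=⇒lookup j∈A) A[j])))

  singletonsIn : List (Subset n) → List (Fin n)
  singletonsIn L = filter (λ i → ⁅ i ⁆ ∈? L) (allFin n)

  pairs : List (List (Subset n)) → List Code
  pairs = concatMap (λ L → map (_, L) (singletonsIn L))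

  encode⊆pairs : ∀ A Ls → encode A Ls ⊑ pairs Ls
  encode⊆pairs A []       = []
  encode⊆pairs A (L ∷ Ls) = ++⁺ entry⊆ (encode⊆pairs A Ls)
    where
    entry⊆ : entry A L ⊑ map (_, L) (singletonsIn L)
    entry⊆ with firstSingleton (after A L) in first
    ... | just i  = from∈ (∈-map⁺ (_, L) (∈-filter⁺ (λ i → ⁅ i ⁆ ∈? L) (∈-allFin i)
                      (after-⊆ L (firstSingleton-∈ (after A L) first))))
    ... | nothing = minimum _

  length-entry≤1 : ∀ A L → length (entry A L) ≤ 1
  length-entry≤1 A L with firstSingleton (after A L)
  ... | just _  = ≤-refl
  ... | nothing = z≤n

  length-encode≤occurrences : ∀ A Ls → length (encode A Ls) ≤ occurrences A Ls
  length-encode≤occurrences A []       = z≤n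
  length-encode≤occurrences A (L ∷ Ls) rewrite length-++ (entry A L) {encode A Ls} with A ∈? L
  ... | yes _   = +-mono-≤ (length-entry≤1 A L) (length-encode≤occurrences A Ls)
  ... | no  A∉L rewrite after-∉ L A∉L = length-encode≤occurrences A Ls

  length-pairs : ∀ Ls → length (pairs Ls) ≡ sum (map (countˡ (λ i L → ⁅ i ⁆ ∈? L) (allFin n)) Ls)
  length-pairs []       = refl
  length-pairs (L ∷ Ls) = trans (length-++ (map (_, L) (singletonsIn L)))
    (cong₂ _+_ (length-map (_, L) (singletonsIn L)) (length-pairs Ls))

  length-pairs≤ : ∀ {k} Ls → (∀ i → occurrences ⁅ i ⁆ Ls ≤ k) → length (pairs Ls) ≤ n * k
  length-pairs≤ {k} Ls occ≤k = begin
    length (pairs Ls)                                        ≡⟨ length-pairs Ls ⟩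
    sum (map (countˡ (λ i L → ⁅ i ⁆ ∈? L) (allFin n)) Ls)    ≡⟨ sum-count-swap (λ i L → ⁅ i ⁆ ∈? L) (allFin n) Ls ⟩
    sum (map (λ i → occurrences ⁅ i ⁆ Ls) (allFin n))       ≤⟨ sum-map-≤ (λ i → occurrences ⁅ i ⁆ Ls) occ≤k (allFin n) ⟩
    length (allFin n) * k                                    ≡⟨ cong (_* k) (length-tabulate {n = n} id) ⟩
    n * k                                                    ∎
    where open ≤-Reasoning

  2^n≤binomialSum : ∀ k → BooleanLdimAtMost n k → 2 ^ n ≤ binomialSum (n * k) k
  2^n≤binomialSum k (Ls , realizer , occ≤k) = begin
    2 ^ n                                    ≤⟨ 2^n≤length n (map decode codes) complete ⟩
    length (map decode codes)                ≡⟨ length-map decode codes ⟩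
    length codes                             ≡⟨ length-sublistsOfLength≤ k (pairs Ls) ⟩
    binomialSum (length (pairs Ls)) k        ≤⟨ binomialSum-monoˡ-≤ k (length-pairs≤ Ls (λ i → occ≤k ⁅ i ⁆)) ⟩
    binomialSum (n * k) k                    ∎
    where
    open ≤-Reasoning
    codes = sublistsOfLength≤ k (pairs Ls)
    complete : ∀ A → A ∈ₗ map decode codes
    complete A = subst (_∈ₗ map decode codes) (decode-encode realizer A)
      (∈-map⁺ decode (∈-sublistsOfLength≤ (encode⊆pairs A Ls)
                        (≤-trans (length-encode≤occurrences A Ls) (occ≤k A))))

mainTheorem8 : ∀ (q : ℕ) → ∃ λ N → ∀ n → N ≤ n → ∀ k →
    BooleanLdimAtMost n k → 2 ^ (q * n) ≤ n ^ (k * suc q)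
mainTheorem8 q = 8 ^ q , λ n 8^q≤n k ldim → 2^[q*n]≤n^[k*[1+q]] q k 8^q≤n (begin
  2 ^ n                  ≤⟨ BooleanLattice.2^n≤binomialSum n k ldim ⟩
  binomialSum (n * k) k  ≤⟨ binomialSum[n*k,k]≤[4*[1+n]]^k n k ⟩
  (4 * suc n) ^ k        ≤⟨ ^-monoˡ-≤ k (4*[1+n]≤8*n (≤-trans (m^n>0 8 q) 8^q≤n)) ⟩
  (8 * n) ^ k            ∎)
  where open ≤-Reasoning
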